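{- For $d \geq 3$, in any $d$-set ridge cover $A_1,\dots,A_d$ of $C^d$, at least one set $A_i$ contains a pair of antipodal $(d-4)$-faces.
   Context: $C^d=[0,1]^d$. A nonempty $k$-face of $C^d$ is given by a word in $\{0,1,X\}^d$ with exactly $k$ letters $X$ (the face is the set of points agreeing with the word in the non-$X$, "fixed", positions). The empty set is regarded as the face of dimension $-1$ and is antipodal to itself. Two $k$-faces are antipodal iff they have exactly the same fixed positions and differ in every fixed position. A ridge is a $(d-2)$-face. A $d$-set ridge cover of $C^d$ is a collection of $d$ sets $A_1,\dots,A_d$, each a union of ridges, such that every ridge is contained in at least one $A_i$. A set contains a pair of antipodal $k$-faces if two antipodal $k$-faces are both contained in it. -}

module Defs where

open import Data.Nat using (ℕ; zero; suc; _∸_)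
open import Data.Fin using (Fin; zero; suc)
open import Data.Integer using (ℤ; +_; -[1+_]; _-_)
open import Data.Bool using (Bool; true)
open import Data.Product using (Σ; _×_; ∃; proj₁)
open import Data.Sum using (_⊎_)
open import Data.Unit using (⊤)
open import Data.Empty using (⊥)
open import Relation.Binary.PropositionalEquality using (_≡_; _≢_)

-- Letters of a face word: fixed 0, fixed 1, or free X.
data Letter : Set where
  L0 L1 X : Letter

Word : ℕ → Set
Word d = Fin d → Letter

numX : ∀ {d} → Word d → ℕ
numX {zero} w = zero
numX {suc d} w with w zero
... | X  = suc (numX (λ j → w (suc j)))
... | L0 = numX (λ j → w (suc j))
... | L1 = numX (λ j → w (suc j))

-- Faces of C^d, including the empty face (dimension -1).
data Face (d : ℕ) : Set where
  ∅face : Face d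
  face  : Word d → Face d

dim : ∀ {d} → Face d → ℤ
dim ∅face    = -[1+ 0 ]
dim (face w) = + numX w

Ridge : ℕ → Set
Ridge d = Σ (Word d) (λ w → numX w ≡ d ∸ 2)

RidgeUnion : ℕ → Set
RidgeUnion d = Ridge d → Bool

-- Containment of nonempty faces as point sets: v ⊆ w iff every fixed
-- position of w is fixed in v with the same value.
_⊑_ : ∀ {d} → Word d → Word d → Set
v ⊑ w = ∀ j → (w j ≡ X) ⊎ (w j ≡ v j)

_⊆U_ : ∀ {d} → Face d → RidgeUnion d → Set
_⊆U_ ∅face A = ⊤
_⊆U_ {d} (face v) A = ∃ λ (r : Ridge d) → (A r ≡ true) × (v ⊑ proj₁ r)

AntiLetter : Letter → Letter → Set
AntiLetter X  X  = ⊤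
AntiLetter L0 L1 = ⊤
AntiLetter L1 L0 = ⊤
AntiLetter _  _  = ⊥

-- Antipodal faces: the empty face is antipodal to itself; nonempty faces
-- are antipodal iff same fixed positions and differ in every fixed position.
Antipodal : ∀ {d} → Face d → Face d → Set
Antipodal ∅face    ∅face    = ⊤
Antipodal (face v) (face w) = ∀ j → AntiLetter (v j) (w j)
Antipodal _        _        = ⊥

ContainsAntipodalPair : ∀ {d} → ℤ → RidgeUnion d → Set
ContainsAntipodalPair {d} k A =
  Σ (Face d) λ F → Σ (Face d) λ G →
    (dim F ≡ k) × (dim G ≡ k) × Antipodal F G × (F ⊆U A) × (G ⊆U A)

IsRidgeCover : ∀ {d} → (Fin d → RidgeUnion d) → Set
IsRidgeCover {d} A = ∀ (r : Ridge d) → ∃ λ i → A i r ≡ true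

-- A ridge fixes two coordinates, i.e. two literals (position, value) at different positions, so
-- ridges are the edges of the graph on the 2d literals joining literals at different positions.
-- If the literal sets of two ridges are disjoint, fixing the literals of the first and the opposites
-- of those of the second (at most four coordinates) gives a (d-4)-face in the first ridge whose
-- antipode lies in the second. A d-set ridge cover is a d-colouring of these edges, so it suffices
-- to find two disjoint edges of one colour. For a derangement σ the edges (k,0)(σ k,1) form a perfect
-- matching, so otherwise the d colours appear once each on it. Taking three rotations σ₁, σ₂, σ₃, the
-- colour of the σ₁-edge at k appears on a σ₂-edge and a σ₃-edge, and the three pairwise meeting
-- edges of this bipartite graph form a star. The edge joining the outer ends of two such stars then
-- has a colour whose σ₁-edge it either misses or whose two spokes it cannot both meet.

module Submission where

open import Defs
open import Data.Bool using (Bool; true; false)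
import Data.Bool.Properties as Bool
open import Data.Empty using (⊥; ⊥-elim)
open import Data.Fin using (Fin; zero; suc; toℕ; punchOut)
import Data.Fin.Properties as Fin
open import Data.Integer using (+_; _-_)
open import Data.Nat using (ℕ; zero; suc; _+_; _∸_; _≤_; _<_; _≥_; z≤n; s≤s; NonZero)
import Data.Nat.Properties as ℕ
open import Algebra.Properties.CommutativeSemigroup ℕ.+-commutativeSemigroup using (interchange; x∙yz≈y∙xz)
open import Data.Nat.DivMod
open import Data.Nat.Solver using (module +-*-Solver)
open import Data.Product using (Σ-syntax; ∃; ∃₂; _×_; _,_; proj₁; proj₂)
open import Data.Product.Properties using (≡-dec)
open import Data.Sum using (_⊎_; inj₁; inj₂; swap; map₂)
open import Data.Unit using (⊤; tt)
open import Data.Vec.Functional using (updateAt; tail; _∷_)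
open import Data.Vec.Functional.Properties using (updateAt-updates; updateAt-minimal)
open import Function using (_∘_; id; const)
open import Relation.Binary.PropositionalEquality
open import Relation.Nullary using (¬_; Dec; yes; no)
open import Relation.Nullary.Decidable using (_⊎-dec_; map′)

open +-*-Solver using (solve; _:+_; _:=_; con)

xCount : Letter → ℕ
xCount X  = 1
xCount L0 = 0
xCount L1 = 0

numX-head : ∀ {d} (w : Word (suc d)) → numX w ≡ xCount (w zero) + numX (tail w)
numX-head w with w zero
... | X  = refl
... | L0 = refl
... | L1 = refl

numX-allX : ∀ d → numX {d} (const X) ≡ d
numX-allX zero    = refl
numX-allX (suc d) = cong suc (numX-allX d)

fixed : Bool → Letter
fixed false = L0
fixed true  = L1

xCount-fixed : ∀ b → xCount (fixed b) ≡ 0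
xCount-fixed false = refl
xCount-fixed true  = refl

numX-fix : ∀ {d} (w : Word d) j b → w j ≡ X →
           numX w ≡ suc (numX (updateAt w j (const (fixed b))))
numX-fix {suc d} w zero b w₀≡X = begin
  numX w                                         ≡⟨ numX-head w ⟩
  xCount (w zero) + numX (tail w)                ≡⟨ cong (λ x → xCount x + numX (tail w)) w₀≡X ⟩
  suc (numX (tail w))                            ≡⟨ cong (λ x → suc (x + numX (tail w))) (sym (xCount-fixed b)) ⟩
  suc (xCount (fixed b) + numX (tail w))         ≡⟨ cong suc (sym (numX-head (updateAt w zero (const (fixed b))))) ⟩
  suc (numX (updateAt w zero (const (fixed b))))   ∎
  where open ≡-Reasoning
numX-fix {suc d} w (suc j) b wⱼ≡X = begin
  numX w                                                  ≡⟨ numX-head w ⟩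
  xCount (w zero) + numX (tail w)                         ≡⟨ cong (λ r → xCount (w zero) + r) (numX-fix (tail w) j b wⱼ≡X) ⟩
  xCount (w zero) + suc (numX (updateAt (tail w) j _))    ≡⟨ ℕ.+-suc _ _ ⟩
  suc (xCount (w zero) + numX (updateAt (tail w) j _))    ≡⟨ cong suc (sym (numX-head (updateAt w (suc j) _))) ⟩
  suc (numX (updateAt w (suc j) (const (fixed b))))       ∎
  where open ≡-Reasoning

opposite : Letter → Letter
opposite L0 = L1
opposite L1 = L0
opposite X  = X

opposite-involutive : ∀ x → opposite (opposite x) ≡ x
opposite-involutive L0 = refl
opposite-involutive L1 = refl
opposite-involutive X  = refl

opposite-antipodal : ∀ x → AntiLetter x (opposite x)
opposite-antipodal L0 = tt
opposite-antipodal L1 = tt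
opposite-antipodal X  = tt

xCount-opposite : ∀ x → xCount (opposite x) ≡ xCount x
xCount-opposite L0 = refl
xCount-opposite L1 = refl
xCount-opposite X  = refl

oppositeWord : ∀ {d} → Word d → Word d
oppositeWord w = opposite ∘ w

numX-opposite : ∀ {d} (w : Word d) → numX (oppositeWord w) ≡ numX w
numX-opposite {zero}  w = refl
numX-opposite {suc d} w = begin
  numX (oppositeWord w)                                     ≡⟨ numX-head (oppositeWord w) ⟩
  xCount (opposite (w zero)) + numX (oppositeWord (tail w)) ≡⟨ cong₂ _+_ (xCount-opposite (w zero)) (numX-opposite (tail w)) ⟩
  xCount (w zero) + numX (tail w)                           ≡⟨ sym (numX-head w) ⟩
  numX w                                                    ∎
  where open ≡-Reasoning

⊑-trans : ∀ {d} {u v w : Word d} → u ⊑ v → v ⊑ w → u ⊑ w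
⊑-trans u⊑v v⊑w j with v⊑w j | u⊑v j
... | inj₁ wⱼ≡X | _          = inj₁ wⱼ≡X
... | inj₂ wⱼ≡vⱼ | inj₁ vⱼ≡X  = inj₁ (trans wⱼ≡vⱼ vⱼ≡X)
... | inj₂ wⱼ≡vⱼ | inj₂ vⱼ≡uⱼ = inj₂ (trans wⱼ≡vⱼ vⱼ≡uⱼ)

⊑-opposite : ∀ {d} {v w : Word d} → v ⊑ oppositeWord w → oppositeWord v ⊑ w
⊑-opposite {v = v} {w} v⊑w′ j with v⊑w′ j
... | inj₁ w′ⱼ≡X  = inj₁ (trans (sym (opposite-involutive (w j))) (cong opposite w′ⱼ≡X))
... | inj₂ w′ⱼ≡vⱼ = inj₂ (trans (sym (opposite-involutive (w j))) (cong opposite w′ⱼ≡vⱼ))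

Agree : Letter → Letter → Set
Agree L0 L1 = ⊥
Agree L1 L0 = ⊥
Agree _  _  = ⊤

Agree-X : ∀ x → Agree x X
Agree-X L0 = tt
Agree-X L1 = tt
Agree-X X  = tt

-- Intersection of faces, letterwise; on letters that do not agree the value is junk.
_⊓_ : Letter → Letter → Letter
X  ⊓ y = y
L0 ⊓ _ = L0
L1 ⊓ _ = L1

meet : ∀ {d} → Word d → Word d → Word d
meet v w j = v j ⊓ w j

meet-⊑ˡ : ∀ {d} (v w : Word d) → meet v w ⊑ v
meet-⊑ˡ v w j with v j
... | X  = inj₁ refl
... | L0 = inj₂ refl
... | L1 = inj₂ refl

⊓-⊑ʳ : ∀ x y → Agree x y → (y ≡ X) ⊎ (y ≡ x ⊓ y)
⊓-⊑ʳ X  y  _ = inj₂ refl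
⊓-⊑ʳ L0 X  _ = inj₁ refl
⊓-⊑ʳ L0 L0 _ = inj₂ refl
⊓-⊑ʳ L1 X  _ = inj₁ refl
⊓-⊑ʳ L1 L1 _ = inj₂ refl

meet-⊑ʳ : ∀ {d} (v w : Word d) → (∀ j → Agree (v j) (w j)) → meet v w ⊑ w
meet-⊑ʳ v w agree j = ⊓-⊑ʳ (v j) (w j) (agree j)

xCount-⊓ : ∀ x y → xCount x + xCount y ≤ suc (xCount (x ⊓ y))
xCount-⊓ X  X  = ℕ.≤-refl
xCount-⊓ X  L0 = ℕ.≤-refl
xCount-⊓ X  L1 = ℕ.≤-refl
xCount-⊓ L0 X  = ℕ.≤-refl
xCount-⊓ L0 L0 = z≤n
xCount-⊓ L0 L1 = z≤n
xCount-⊓ L1 X  = ℕ.≤-refl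
xCount-⊓ L1 L0 = z≤n
xCount-⊓ L1 L1 = z≤n

numX-meet : ∀ {d} (v w : Word d) → numX v + numX w ≤ d + numX (meet v w)
numX-meet {zero}  v w = z≤n
numX-meet {suc d} v w = begin
  numX v + numX w                                   ≡⟨ cong₂ _+_ (numX-head v) (numX-head w) ⟩
  (xCount (v zero) + numX (tail v)) + (xCount (w zero) + numX (tail w))
                                                    ≡⟨ interchange (xCount (v zero)) _ _ _ ⟩
  (xCount (v zero) + xCount (w zero)) + (numX (tail v) + numX (tail w))
                                                    ≤⟨ ℕ.+-mono-≤ (xCount-⊓ (v zero) (w zero)) (numX-meet (tail v) (tail w)) ⟩
  suc (xCount (u zero) + (d + numX (tail u)))       ≡⟨ cong suc (x∙yz≈y∙xz (xCount (u zero)) d _) ⟩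
  suc (d + (xCount (u zero) + numX (tail u)))       ≡⟨ cong (λ r → suc d + r) (sym (numX-head u)) ⟩
  suc d + numX u                                    ∎
  where
  open ℕ.≤-Reasoning
  u : Word (suc d)
  u = meet v w

extend-subface : ∀ {d t} {u : Word (suc d)} L → (u zero ≡ X) ⊎ (u zero ≡ L) →
                 Σ[ F ∈ Word d ] numX F ≡ t × F ⊑ tail u →
                 Σ[ F ∈ Word (suc d) ] numX F ≡ xCount L + t × F ⊑ u
extend-subface L u₀ (F , numX-F , F⊑u′) =
  L ∷ F , trans (numX-head (L ∷ F)) (cong (λ r → xCount L + r) numX-F) , λ { zero → u₀ ; (suc j) → F⊑u′ j }

subface-with-numX : ∀ {d} (u : Word d) t → t ≤ numX u → Σ[ F ∈ Word d ] numX F ≡ t × F ⊑ u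
subface-with-numX {zero}  u zero    _ = u , refl , λ ()
subface-with-numX {suc d} u t t≤ with u zero in u₀≡
... | L0 = extend-subface L0 (inj₂ u₀≡) (subface-with-numX (tail u) t t≤)
... | L1 = extend-subface L1 (inj₂ u₀≡) (subface-with-numX (tail u) t t≤)
subface-with-numX {suc d} u zero    _          | X = extend-subface L0 (inj₁ u₀≡) (subface-with-numX (tail u) zero z≤n)
subface-with-numX {suc d} u (suc t) (s≤s t≤)   | X = extend-subface X (inj₁ u₀≡) (subface-with-numX (tail u) t t≤)

antipodal-subfaces : ∀ {d} t (v w : Word d) → (∀ j → Agree (v j) (opposite (w j))) →
                     t + d ≤ numX v + numX w →
                     Σ[ F ∈ Word d ] numX F ≡ t × F ⊑ v × oppositeWord F ⊑ w
antipodal-subfaces {d} t v w agree bound =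
  let F , numX-F , F⊑u = subface-with-numX u t t≤numX-u
  in F , numX-F , ⊑-trans F⊑u (meet-⊑ˡ v w′) , ⊑-opposite (⊑-trans F⊑u (meet-⊑ʳ v w′ agree))
  where
  w′ u : Word d
  w′ = oppositeWord w
  u  = meet v w′
  t≤numX-u : t ≤ numX u
  t≤numX-u = ℕ.+-cancelʳ-≤ d t (numX u) (begin
    t + d                ≤⟨ bound ⟩
    numX v + numX w      ≡⟨ cong (λ r → numX v + r) (sym (numX-opposite w)) ⟩
    numX v + numX w′     ≤⟨ numX-meet v w′ ⟩
    d + numX u           ≡⟨ ℕ.+-comm d (numX u) ⟩
    numX u + d           ∎)
    where open ℕ.≤-Reasoning

-- Ridges as edges between literals

Literal : ℕ → Set
Literal d = Fin d × Bool

_≟ˡ_ : ∀ {d} (x y : Literal d) → Dec (x ≡ y)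
_≟ˡ_ = ≡-dec Fin._≟_ Bool._≟_

record Edge (d : ℕ) : Set where
  constructor edge
  field
    end₁ end₂ : Literal d
    positions-differ : proj₁ end₁ ≢ proj₁ end₂

open Edge public

_∈ᵉ_ : ∀ {d} → Literal d → Edge d → Set
x ∈ᵉ e = x ≡ end₁ e ⊎ x ≡ end₂ e

Meet : ∀ {d} → Edge d → Edge d → Set
Meet {d} e f = Σ[ x ∈ Literal d ] x ∈ᵉ e × x ∈ᵉ f

Disjoint : ∀ {d} → Edge d → Edge d → Set
Disjoint e f = ¬ Meet e f

meet? : ∀ {d} (e f : Edge d) → Dec (Meet e f)
meet? e f = map′ common endpoint-common (end₁ e ∈? f ⊎-dec end₂ e ∈? f)
  where
  _∈?_ : ∀ x f → Dec (x ∈ᵉ f)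
  x ∈? f = (x ≟ˡ end₁ f) ⊎-dec (x ≟ˡ end₂ f)
  common : end₁ e ∈ᵉ f ⊎ end₂ e ∈ᵉ f → Meet e f
  common (inj₁ x∈f) = end₁ e , inj₁ refl , x∈f
  common (inj₂ x∈f) = end₂ e , inj₂ refl , x∈f
  endpoint-common : Meet e f → end₁ e ∈ᵉ f ⊎ end₂ e ∈ᵉ f
  endpoint-common (_ , inj₁ refl , x∈f) = inj₁ x∈f
  endpoint-common (_ , inj₂ refl , x∈f) = inj₂ x∈f

ridgeWord : ∀ {d} → Edge d → Word d
ridgeWord (edge (j , a) (k , b) _) = updateAt (updateAt (const X) j (const (fixed a))) k (const (fixed b))

numX-ridgeWord : ∀ {d} (e : Edge d) → numX (ridgeWord e) ≡ d ∸ 2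
numX-ridgeWord {d} (edge (j , a) (k , b) j≢k) = sym (cong (_∸ 2) (begin
  d                                          ≡⟨ numX-allX d ⟨
  numX {d} (const X)                         ≡⟨ numX-fix (const X) j a refl ⟩
  suc (numX w)                               ≡⟨ cong suc (numX-fix w k b (updateAt-minimal k j (const X) (j≢k ∘ sym))) ⟩
  suc (suc (numX (ridgeWord (edge (j , a) (k , b) j≢k)))) ∎))
  where
  open ≡-Reasoning
  w : Word d
  w = updateAt (const X) j (const (fixed a))

ridge : ∀ {d} → Edge d → Ridge d
ridge e = ridgeWord e , numX-ridgeWord e

ridgeWord-letter : ∀ {d} (e : Edge d) m →
                   ridgeWord e m ≡ X ⊎ Σ[ b ∈ Bool ] ridgeWord e m ≡ fixed b × (m , b) ∈ᵉ e
ridgeWord-letter (edge (j , a) (k , b) _) m with m Fin.≟ k | m Fin.≟ j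
... | yes refl | _        = inj₂ (b , updateAt-updates m _ , inj₂ refl)
... | no m≢k   | yes refl = inj₂ (a , trans (updateAt-minimal m k _ m≢k) (updateAt-updates m _) , inj₁ refl)
... | no m≢k   | no m≢j   = inj₁ (trans (updateAt-minimal m k _ m≢k) (updateAt-minimal m j _ m≢j))

agree-fixed : ∀ {a b} → a ≢ b → Agree (fixed a) (opposite (fixed b))
agree-fixed {false} {false} a≢b = ⊥-elim (a≢b refl)
agree-fixed {false} {true}  _   = tt
agree-fixed {true}  {false} _   = tt
agree-fixed {true}  {true}  a≢b = ⊥-elim (a≢b refl)

disjoint-ridges-agree : ∀ {d} (e f : Edge d) → Disjoint e f →
                        ∀ m → Agree (ridgeWord e m) (opposite (ridgeWord f m))
disjoint-ridges-agree e f e∩f=∅ m with ridgeWord-letter e m | ridgeWord-letter f m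
... | inj₁ eₘ≡X | _ rewrite eₘ≡X = tt
... | inj₂ _ | inj₁ fₘ≡X rewrite fₘ≡X = Agree-X (ridgeWord e m)
... | inj₂ (a , eₘ≡a , a∈e) | inj₂ (b , fₘ≡b , b∈f) rewrite eₘ≡a | fₘ≡b =
  agree-fixed λ { refl → e∩f=∅ ((m , a) , a∈e , b∈f) }

two-ridges : ∀ n → n + (4 + n) ≡ (2 + n) + (2 + n)
two-ridges = solve 1 (λ n → n :+ (con 4 :+ n) := (con 2 :+ n) :+ (con 2 :+ n)) refl

disjoint-ridges-antipodal-pair : ∀ n (A : RidgeUnion (4 + n)) (e f : Edge (4 + n)) →
  A (ridge e) ≡ true → A (ridge f) ≡ true → Disjoint e f →
  ContainsAntipodalPair (+ (4 + n) - + 4) A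
disjoint-ridges-antipodal-pair n A e f e∈A f∈A e∩f=∅ =
  let F , numX-F , F⊑e , F′⊑f = antipodal-subfaces n (ridgeWord e) (ridgeWord f)
                                  (disjoint-ridges-agree e f e∩f=∅) two-ridges-bound
  in face F , face (oppositeWord F) , cong +_ numX-F , cong +_ (trans (numX-opposite F) numX-F) ,
     (λ j → opposite-antipodal (F j)) , (ridge e , e∈A , F⊑e) , (ridge f , f∈A , F′⊑f)
  where
  two-ridges-bound : n + (4 + n) ≤ numX (ridgeWord e) + numX (ridgeWord f)
  two-ridges-bound = ℕ.≤-reflexive (trans (two-ridges n)
    (cong₂ _+_ (sym (numX-ridgeWord e)) (sym (numX-ridgeWord f))))

different-positions : ∀ {d} {x y z : Literal d} → x ≢ y → x ≢ z → y ≢ z →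
                      proj₁ x ≢ proj₁ y ⊎ proj₁ x ≢ proj₁ z ⊎ proj₁ y ≢ proj₁ z
different-positions {x = i , a} {j , b} {k , c} x≢y x≢z y≢z with i Fin.≟ j | i Fin.≟ k
... | no i≢j   | _        = inj₁ i≢j
... | yes _    | no i≢k   = inj₂ (inj₁ i≢k)
... | yes refl | yes refl with a Bool.≟ b | a Bool.≟ c
...   | yes refl | _        = ⊥-elim (x≢y refl)
...   | no _     | yes refl = ⊥-elim (x≢z refl)
...   | no a≢b   | no a≢c   =
  ⊥-elim (y≢z (cong (i ,_) (Bool.not-injective (trans (sym (Bool.¬-not a≢b)) (Bool.¬-not a≢c)))))

-- Matchings from derangements

hit-or-collide : ∀ {n} (f : Fin n → Fin n) i →
                 (∃ λ k → f k ≡ i) ⊎ (∃₂ λ k k′ → k ≢ k′ × f k ≡ f k′)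
hit-or-collide {suc n} f i with Fin.any? (λ k → f k Fin.≟ i)
... | yes hit = inj₁ hit
... | no miss =
  let k , k′ , k<k′ , eq = Fin.pigeonhole (ℕ.n<1+n n) (λ k → punchOut (f≢i k))
  in inj₂ (k , k′ , Fin.<⇒≢ k<k′ , Fin.punchOut-injective (f≢i k) (f≢i k′) eq)
  where
  f≢i : ∀ k → i ≢ f k
  f≢i k i≡fk = miss (k , sym i≡fk)

record Derangement (d : ℕ) : Set where
  field
    apply            : Fin d → Fin d
    injective        : ∀ {k k′} → apply k ≡ apply k′ → k ≡ k′
    fixed-point-free : ∀ k → k ≢ apply k

open Derangement

matchEdge : ∀ {d} → Derangement d → Fin d → Edge d
matchEdge σ k = edge (k , false) (apply σ k , true) (fixed-point-free σ k)

matchEdges-meet : ∀ {d} (σ τ : Derangement d) {k m} → Meet (matchEdge σ k) (matchEdge τ m) →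
                  k ≡ m ⊎ apply σ k ≡ apply τ m
matchEdges-meet σ τ (_ , inj₁ refl , inj₁ eq) = inj₁ (cong proj₁ eq)
matchEdges-meet σ τ (_ , inj₂ refl , inj₂ eq) = inj₂ (cong proj₁ eq)

matchEdges-disjoint : ∀ {d} (σ : Derangement d) {k k′} → k ≢ k′ →
                      Disjoint (matchEdge σ k) (matchEdge σ k′)
matchEdges-disjoint σ k≢k′ meet with matchEdges-meet σ σ meet
... | inj₁ k≡k′   = k≢k′ k≡k′
... | inj₂ σk≡σk′ = k≢k′ (injective σ σk≡σk′)

matchEdge-unique : ∀ {d} (σ : Derangement d) {x k k′} →
                   x ∈ᵉ matchEdge σ k → x ∈ᵉ matchEdge σ k′ → k ≡ k′
matchEdge-unique σ {x} {k} {k′} x∈k x∈k′ with k Fin.≟ k′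
... | yes k≡k′ = k≡k′
... | no k≢k′  = ⊥-elim (matchEdges-disjoint σ k≢k′ (x , x∈k , x∈k′))

[m%n+o]%n≡[m+o]%n : ∀ m o n .{{_ : NonZero n}} → (m % n + o) % n ≡ (m + o) % n
[m%n+o]%n≡[m+o]%n m o n = begin
  (m % n + o) % n            ≡⟨ %-distribˡ-+ (m % n) o n ⟩
  (m % n % n + o % n) % n    ≡⟨ cong (λ r → (r + o % n) % n) (m%n%n≡m%n m n) ⟩
  (m % n + o % n) % n        ≡⟨ %-distribˡ-+ m o n ⟨
  (m + o) % n                ∎
  where open ≡-Reasoning

module Rotation (d : ℕ) .{{_ : NonZero d}} where

  rotate : ℕ → Fin d → Fin d
  rotate s k = (toℕ k + s) mod d

  toℕ-rotate : ∀ s k → toℕ (rotate s k) ≡ (toℕ k + s) % d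
  toℕ-rotate s k = Fin.toℕ-fromℕ< _

  toℕ-rotate² : ∀ s t k → toℕ (rotate t (rotate s k)) ≡ (toℕ k + s + t) % d
  toℕ-rotate² s t k = begin
    toℕ (rotate t (rotate s k))     ≡⟨ toℕ-rotate t (rotate s k) ⟩
    (toℕ (rotate s k) + t) % d      ≡⟨ cong (λ r → (r + t) % d) (toℕ-rotate s k) ⟩
    ((toℕ k + s) % d + t) % d       ≡⟨ [m%n+o]%n≡[m+o]%n (toℕ k + s) t d ⟩
    (toℕ k + s + t) % d             ∎
    where open ≡-Reasoning

  rotate-inverse : ∀ {s} → s ≤ d → ∀ k → rotate (d ∸ s) (rotate s k) ≡ k
  rotate-inverse {s} s≤d k = Fin.toℕ-injective (begin
    toℕ (rotate (d ∸ s) (rotate s k))  ≡⟨ toℕ-rotate² s (d ∸ s) k ⟩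
    (toℕ k + s + (d ∸ s)) % d          ≡⟨ cong (_% d) (ℕ.+-assoc (toℕ k) s (d ∸ s)) ⟩
    (toℕ k + (s + (d ∸ s))) % d        ≡⟨ cong (λ r → (toℕ k + r) % d) (ℕ.m+[n∸m]≡n s≤d) ⟩
    (toℕ k + d) % d                    ≡⟨ [m+n]%n≡m%n (toℕ k) d ⟩
    toℕ k % d                          ≡⟨ m<n⇒m%n≡m (Fin.toℕ<n k) ⟩
    toℕ k                              ∎)
    where open ≡-Reasoning

  rotate-injective : ∀ {s} → s ≤ d → ∀ {k k′} → rotate s k ≡ rotate s k′ → k ≡ k′
  rotate-injective {s} s≤d {k} {k′} eq = begin
    k                                   ≡⟨ rotate-inverse s≤d k ⟨
    rotate (d ∸ s) (rotate s k)         ≡⟨ cong (rotate (d ∸ s)) eq ⟩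
    rotate (d ∸ s) (rotate s k′)        ≡⟨ rotate-inverse s≤d k′ ⟩
    k′                                  ∎
    where open ≡-Reasoning

  toℕ-rotate-back : ∀ {s} → s < d → ∀ k → toℕ (rotate (d ∸ toℕ k) (rotate s k)) ≡ s
  toℕ-rotate-back {s} s<d k = begin
    toℕ (rotate (d ∸ toℕ k) (rotate s k))  ≡⟨ toℕ-rotate² s (d ∸ toℕ k) k ⟩
    (toℕ k + s + (d ∸ toℕ k)) % d          ≡⟨ cong (λ r → (r + (d ∸ toℕ k)) % d) (ℕ.+-comm (toℕ k) s) ⟩
    (s + toℕ k + (d ∸ toℕ k)) % d          ≡⟨ cong (_% d) (ℕ.+-assoc s (toℕ k) (d ∸ toℕ k)) ⟩
    (s + (toℕ k + (d ∸ toℕ k))) % d        ≡⟨ cong (λ r → (s + r) % d) (ℕ.m+[n∸m]≡n (ℕ.<⇒≤ (Fin.toℕ<n k))) ⟩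
    (s + d) % d                            ≡⟨ [m+n]%n≡m%n s d ⟩
    s % d                                  ≡⟨ m<n⇒m%n≡m s<d ⟩
    s                                      ∎
    where open ≡-Reasoning

  rotate-injectiveˡ : ∀ {s t} → s < d → t < d → ∀ k → rotate s k ≡ rotate t k → s ≡ t
  rotate-injectiveˡ {s} {t} s<d t<d k eq = begin
    s                                      ≡⟨ toℕ-rotate-back s<d k ⟨
    toℕ (rotate (d ∸ toℕ k) (rotate s k))  ≡⟨ cong (toℕ ∘ rotate (d ∸ toℕ k)) eq ⟩
    toℕ (rotate (d ∸ toℕ k) (rotate t k))  ≡⟨ toℕ-rotate-back t<d k ⟩
    t                                      ∎
    where open ≡-Reasoning

  rotate-zero : ∀ k → rotate 0 k ≡ k
  rotate-zero k = Fin.toℕ-injective (begin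
    toℕ (rotate 0 k)  ≡⟨ toℕ-rotate 0 k ⟩
    (toℕ k + 0) % d   ≡⟨ cong (_% d) (ℕ.+-identityʳ (toℕ k)) ⟩
    toℕ k % d         ≡⟨ m<n⇒m%n≡m (Fin.toℕ<n k) ⟩
    toℕ k             ∎)
    where open ≡-Reasoning

rotation : ∀ {m s} → 0 < s → s < suc m → Derangement (suc m)
rotation {m} {s} 0<s s<d = record
  { apply            = rotate s
  ; injective        = rotate-injective (ℕ.<⇒≤ s<d)
  ; fixed-point-free = λ k k≡ → ℕ.<⇒≢ 0<s
    (rotate-injectiveˡ (ℕ.<-trans 0<s s<d) s<d k (trans (rotate-zero k) k≡))
  }
  where open Rotation (suc m)

rotations-differ : ∀ {m s t} (s<d : s < suc m) (t<d : t < suc m) → s ≢ t →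
                   ∀ k → Rotation.rotate (suc m) s k ≢ Rotation.rotate (suc m) t k
rotations-differ {m} s<d t<d s≢t k = s≢t ∘ Rotation.rotate-injectiveˡ (suc m) s<d t<d k

-- Colourings of the literal graph

DisjointMonochromaticPair : ∀ {d} → (Edge d → Fin d) → Set
DisjointMonochromaticPair {d} colour =
  Σ[ e ∈ Edge d ] Σ[ f ∈ Edge d ] colour e ≡ colour f × Disjoint e f

module Colouring {m} (colour : Edge (suc m) → Fin (suc m)) (σ₁ σ₂ σ₃ : Derangement (suc m))
  (σ₁≢σ₂ : ∀ k → apply σ₁ k ≢ apply σ₂ k)
  (σ₁≢σ₃ : ∀ k → apply σ₁ k ≢ apply σ₃ k)
  (σ₂≢σ₃ : ∀ k → apply σ₂ k ≢ apply σ₃ k) where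

  private
    d : ℕ
    d = suc m
    Pair : Set
    Pair = DisjointMonochromaticPair colour
    M₁ M₂ M₃ : Fin d → Edge d
    M₁ = matchEdge σ₁
    M₂ = matchEdge σ₂
    M₃ = matchEdge σ₃

  colour-in-matching : ∀ σ c → (∃ λ k → colour (matchEdge σ k) ≡ c) ⊎ Pair
  colour-in-matching σ c with hit-or-collide (colour ∘ matchEdge σ) c
  ... | inj₁ hit = inj₁ hit
  ... | inj₂ (k , k′ , k≢k′ , same) =
    inj₂ (matchEdge σ k , matchEdge σ k′ , same , matchEdges-disjoint σ k≢k′)

  -- σ-edges join false-literals to true-literals, so three pairwise meeting ones cannot form a triangle.
  common-endpoint : ∀ {k m₂ m₃} → Meet (M₁ k) (M₂ m₂) → Meet (M₁ k) (M₃ m₃) → Meet (M₂ m₂) (M₃ m₃) →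
                    (k ≡ m₂ × k ≡ m₃) ⊎ (apply σ₁ k ≡ apply σ₂ m₂ × apply σ₁ k ≡ apply σ₃ m₃)
  common-endpoint {k} M₁∩M₂ M₁∩M₃ M₂∩M₃
    with matchEdges-meet σ₁ σ₂ M₁∩M₂ | matchEdges-meet σ₁ σ₃ M₁∩M₃ | matchEdges-meet σ₂ σ₃ M₂∩M₃
  ... | inj₁ k≡m₂ | inj₁ k≡m₃ | _        = inj₁ (k≡m₂ , k≡m₃)
  ... | inj₂ e₁₂  | inj₂ e₁₃  | _        = inj₂ (e₁₂ , e₁₃)
  ... | inj₁ refl | inj₂ e₁₃  | inj₁ refl = ⊥-elim (σ₁≢σ₃ k e₁₃)
  ... | inj₁ refl | inj₂ e₁₃  | inj₂ e₂₃ = ⊥-elim (σ₁≢σ₂ k (trans e₁₃ (sym e₂₃)))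
  ... | inj₂ e₁₂  | inj₁ refl | inj₁ refl = ⊥-elim (σ₁≢σ₂ k e₁₂)
  ... | inj₂ e₁₂  | inj₁ refl | inj₂ e₂₃ = ⊥-elim (σ₁≢σ₃ k (trans e₁₂ e₂₃))

  record Spoke (k : Fin d) (centre outer : Literal d) : Set where
    field
      spoke        : Edge d
      tip          : Literal d
      spoke-colour : colour spoke ≡ colour (M₁ k)
      spoke-ends   : ∀ {x} → x ∈ᵉ spoke → x ≡ centre ⊎ x ≡ tip
      tip≢outer    : tip ≢ outer

  open Spoke

  record Star (k : Fin d) : Set where
    field
      centre outer  : Literal d
      centre∈       : centre ∈ᵉ M₁ k
      outer∈        : outer ∈ᵉ M₁ k
      centre≢outer  : centre ≢ outer
      spoke₂ spoke₃ : Spoke k centre outer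
      tips-differ   : tip spoke₂ ≢ tip spoke₃

  open Star

  spoke-at-source : ∀ {k} τ → (∀ k → apply σ₁ k ≢ apply τ k) → colour (matchEdge τ k) ≡ colour (M₁ k) →
                    Spoke k (k , false) (apply σ₁ k , true)
  spoke-at-source {k} τ σ₁≢τ same = record
    { spoke = matchEdge τ k ; tip = apply τ k , true ; spoke-colour = same
    ; spoke-ends = id ; tip≢outer = σ₁≢τ k ∘ sym ∘ cong proj₁ }

  spoke-at-target : ∀ {k m} τ → (∀ k → apply σ₁ k ≢ apply τ k) → apply σ₁ k ≡ apply τ m →
                    colour (matchEdge τ m) ≡ colour (M₁ k) → Spoke k (apply σ₁ k , true) (k , false)
  spoke-at-target {k} {m} τ σ₁≢τ σ₁k≡τm same = record
    { spoke = matchEdge τ m ; tip = m , false ; spoke-colour = same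
    ; spoke-ends = swap ∘ map₂ (λ x≡τm → trans x≡τm (cong (_, true) (sym σ₁k≡τm)))
    ; tip≢outer = λ m,f≡k,f → σ₁≢τ k (trans σ₁k≡τm (cong (apply τ ∘ proj₁) m,f≡k,f)) }

  star-or-pair : ∀ k → Star k ⊎ Pair
  star-or-pair k with colour-in-matching σ₂ (colour (M₁ k)) | colour-in-matching σ₃ (colour (M₁ k))
  ... | inj₂ P | _      = inj₂ P
  ... | inj₁ _ | inj₂ P = inj₂ P
  ... | inj₁ (m₂ , c₂) | inj₁ (m₃ , c₃) with meet? (M₁ k) (M₂ m₂) | meet? (M₁ k) (M₃ m₃) | meet? (M₂ m₂) (M₃ m₃)
  ...   | no ¬M₁∩M₂ | _         | _         = inj₂ (M₁ k , M₂ m₂ , sym c₂ , ¬M₁∩M₂)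
  ...   | yes _     | no ¬M₁∩M₃ | _         = inj₂ (M₁ k , M₃ m₃ , sym c₃ , ¬M₁∩M₃)
  ...   | yes _     | yes _     | no ¬M₂∩M₃ = inj₂ (M₂ m₂ , M₃ m₃ , trans c₂ (sym c₃) , ¬M₂∩M₃)
  ...   | yes M₁∩M₂ | yes M₁∩M₃ | yes M₂∩M₃ with common-endpoint M₁∩M₂ M₁∩M₃ M₂∩M₃
  ...     | inj₁ (refl , refl) = inj₁ record
    { centre = k , false ; outer = apply σ₁ k , true
    ; centre∈ = inj₁ refl ; outer∈ = inj₂ refl ; centre≢outer = λ ()
    ; spoke₂ = spoke-at-source σ₂ σ₁≢σ₂ c₂ ; spoke₃ = spoke-at-source σ₃ σ₁≢σ₃ c₃
    ; tips-differ = σ₂≢σ₃ k ∘ cong proj₁ }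
  ...     | inj₂ (e₁₂ , e₁₃) = inj₁ record
    { centre = apply σ₁ k , true ; outer = k , false
    ; centre∈ = inj₂ refl ; outer∈ = inj₁ refl ; centre≢outer = λ ()
    ; spoke₂ = spoke-at-target σ₂ σ₁≢σ₂ e₁₂ c₂ ; spoke₃ = spoke-at-target σ₃ σ₁≢σ₃ e₁₃ c₃
    ; tips-differ = λ m₂,f≡m₃,f → σ₂≢σ₃ m₃
        (trans (cong (apply σ₂ ∘ proj₁) (sym m₂,f≡m₃,f)) (trans (sym e₁₂) e₁₃)) }

  module _ {a} (S : Star a) {b v} (b≢a : b ≢ a) (v∈ : v ∈ᵉ M₁ b) (e : Edge d)
           (e-ends : ∀ {x} → x ∈ᵉ e → x ≡ outer S ⊎ x ≡ v) where

    meets-spoke-at-tip : (s : Spoke a (centre S) (outer S)) → Meet e (spoke s) → v ≡ tip s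
    meets-spoke-at-tip s (x , x∈e , x∈s) with e-ends x∈e | spoke-ends s x∈s
    ... | inj₁ x≡o | inj₁ x≡c = ⊥-elim (centre≢outer S (trans (sym x≡c) x≡o))
    ... | inj₁ x≡o | inj₂ x≡t = ⊥-elim (tip≢outer s (trans (sym x≡t) x≡o))
    ... | inj₂ x≡v | inj₁ x≡c = ⊥-elim (b≢a (matchEdge-unique σ₁ v∈ (subst (_∈ᵉ M₁ a) (trans (sym x≡c) x≡v) (centre∈ S))))
    ... | inj₂ x≡v | inj₂ x≡t = trans (sym x≡v) x≡t

    -- e meets a spoke neither at the centre nor at outer S, so it meets both spokes at their tips.
    pair-through-outer : colour e ≡ colour (M₁ a) → Pair
    pair-through-outer same with meet? e (spoke (spoke₂ S)) | meet? e (spoke (spoke₃ S))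
    ... | no ¬meet | _        = e , spoke (spoke₂ S) , trans same (sym (spoke-colour (spoke₂ S))) , ¬meet
    ... | yes _    | no ¬meet = e , spoke (spoke₃ S) , trans same (sym (spoke-colour (spoke₃ S))) , ¬meet
    ... | yes meet₂ | yes meet₃ = ⊥-elim (tips-differ S
      (trans (sym (meets-spoke-at-tip (spoke₂ S) meet₂)) (meets-spoke-at-tip (spoke₃ S) meet₃)))

  outers-differ : ∀ {a b} → a ≢ b → (S : Star a) (T : Star b) → outer S ≢ outer T
  outers-differ a≢b S T o≡o = a≢b (matchEdge-unique σ₁ (outer∈ S) (subst (_∈ᵉ M₁ _) (sym o≡o) (outer∈ T)))

  pair-from-stars : ∀ {a b} → a ≢ b → (S : Star a) (T : Star b) → proj₁ (outer S) ≢ proj₁ (outer T) → Pair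
  pair-from-stars {a} {b} a≢b S T positions-differ = pair (colour-in-matching σ₁ (colour e))
    where
    e : Edge d
    e = edge (outer S) (outer T) positions-differ
    pair : (∃ λ k → colour (M₁ k) ≡ colour e) ⊎ Pair → Pair
    pair (inj₂ P) = P
    pair (inj₁ (k , same)) with k Fin.≟ a | k Fin.≟ b
    ... | yes refl | _        = pair-through-outer S (a≢b ∘ sym) (outer∈ T) e id (sym same)
    ... | no _     | yes refl = pair-through-outer T a≢b (outer∈ S) e swap (sym same)
    ... | no k≢a   | no k≢b   = e , M₁ k , sym same , λ where
      (x , inj₁ x≡o , x∈M₁k) → k≢a (matchEdge-unique σ₁ x∈M₁k (subst (_∈ᵉ M₁ a) (sym x≡o) (outer∈ S)))
      (x , inj₂ x≡o , x∈M₁k) → k≢b (matchEdge-unique σ₁ x∈M₁k (subst (_∈ᵉ M₁ b) (sym x≡o) (outer∈ T)))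

  private
    k₀ k₁ k₂ : Fin d
    k₀ = zero
    k₁ = apply σ₁ zero
    k₂ = apply σ₂ zero
    k₀≢k₁ : k₀ ≢ k₁
    k₀≢k₁ = fixed-point-free σ₁ zero
    k₀≢k₂ : k₀ ≢ k₂
    k₀≢k₂ = fixed-point-free σ₂ zero
    k₁≢k₂ : k₁ ≢ k₂
    k₁≢k₂ = σ₁≢σ₂ zero

  disjoint-monochromatic-pair : Pair
  disjoint-monochromatic-pair with star-or-pair k₀ | star-or-pair k₁ | star-or-pair k₂
  ... | inj₂ P  | _       | _       = P
  ... | inj₁ _  | inj₂ P  | _       = P
  ... | inj₁ _  | inj₁ _  | inj₂ P  = P
  ... | inj₁ S₀ | inj₁ S₁ | inj₁ S₂
    with different-positions (outers-differ k₀≢k₁ S₀ S₁) (outers-differ k₀≢k₂ S₀ S₂) (outers-differ k₁≢k₂ S₁ S₂)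
  ...   | inj₁ ne        = pair-from-stars k₀≢k₁ S₀ S₁ ne
  ...   | inj₂ (inj₁ ne) = pair-from-stars k₀≢k₂ S₀ S₂ ne
  ...   | inj₂ (inj₂ ne) = pair-from-stars k₁≢k₂ S₁ S₂ ne

colouring-disjoint-monochromatic-pair : ∀ n (colour : Edge (4 + n) → Fin (4 + n)) →
                                        DisjointMonochromaticPair colour
colouring-disjoint-monochromatic-pair n colour =
  Colouring.disjoint-monochromatic-pair colour (rotation 0<s 1<d) (rotation 0<s 2<d) (rotation 0<s 3<d)
    (rotations-differ 1<d 2<d (λ ())) (rotations-differ 1<d 3<d (λ ())) (rotations-differ 2<d 3<d (λ ()))
  where
  0<s : ∀ {s} → 0 < suc s
  0<s = s≤s z≤n
  1<d : 1 < 4 + n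
  1<d = s≤s (s≤s z≤n)
  2<d : 2 < 4 + n
  2<d = s≤s (s≤s (s≤s z≤n))
  3<d : 3 < 4 + n
  3<d = s≤s (s≤s (s≤s (s≤s z≤n)))

theorem3 : (d : ℕ) → d ≥ 3 → (A : Fin d → RidgeUnion d) → IsRidgeCover A →
    ∃ λ (i : Fin d) → ContainsAntipodalPair (+ d - + 4) (A i)
theorem3 0 ()
theorem3 1 (s≤s ())
theorem3 2 (s≤s (s≤s ()))
theorem3 3 _ A _ = zero , ∅face , ∅face , refl , refl , _ , _ , _
theorem3 (suc (suc (suc (suc n)))) _ A cover =
  pair-in-colour-class (colouring-disjoint-monochromatic-pair n colour)
  where
  colour : Edge (4 + n) → Fin (4 + n)
  colour e = proj₁ (cover (ridge e))
  pair-in-colour-class : DisjointMonochromaticPair colour →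
                         ∃ λ i → ContainsAntipodalPair (+ (4 + n) - + 4) (A i)
  pair-in-colour-class (e , f , same-colour , disjoint) =
    colour e , disjoint-ridges-antipodal-pair n (A (colour e)) e f
                 (proj₂ (cover (ridge e)))
                 (subst (λ i → A i (ridge f) ≡ true) (sym same-colour) (proj₂ (cover (ridge f))))
                 disjoint
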